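{- Let $V=\{1,\dots,n\}$, let $f:2^V\to\mathbb{R}$ be submodular with $f(\emptyset)=0$, and let $X\subseteq V$. Define $\hat\partial^f(X)=\{x\in\mathbb{R}^n: x(j)\le f(j\mid X\setminus\{j\})\ \forall j\in X,\ x(j)\ge f(\{j\})\ \forall j\notin X\}$, $\check\partial^f(X)=\{x\in\mathbb{R}^n: x(j)\ge f(j\mid X)\ \forall j\notin X,\ x(j)\le f(j\mid V\setminus\{j\})\ \forall j\in X\}$, $\bar\partial^f(X)=\{x\in\mathbb{R}^n: x(j)\le f(j\mid V\setminus\{j\})\ \forall j\in X,\ x(j)\ge f(\{j\})\ \forall j\notin X\}$, $\mathring\partial^f(X)=\{\lambda x_1+(1-\lambda)x_2:\lambda\in[0,1],\ x_1\in\hat\partial^f(X),\ x_2\in\check\partial^f(X)\}$, and $\partial^f(X)=\{x\in\mathbb{R}^n: f(Y)-x(Y)\le f(X)-x(X)\ \forall Y\subseteq V\}$. Then $\bar\partial^f(X)\subseteq\hat\partial^f(X)\subseteq\mathring\partial^f(X)\subseteq\partial^f(X)$ and $\bar\partial^f(X)\subseteq\check\partial^f(X)\subseteq\mathring\partial^f(X)\subseteq\partial^f(X)$.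
   Context: For $x\in\mathbb{R}^n$ and $S\subseteq V$, $x(S)=\sum_{i\in S}x_i$, $x(j)=x_j$. $f(j\mid S)=f(S\cup\{j\})-f(S)$. $f$ is submodular if $f(S)+f(T)\ge f(S\cup T)+f(S\cap T)$ for all $S,T\subseteq V$. -}

module Defs where

open import Level using (Level; _⊔_) renaming (suc to lsuc)
open import Data.Nat using (ℕ; zero; suc)
open import Data.Fin using (Fin; suc)
import Data.Fin as Fin
open import Data.Bool using (true; false)
open import Data.Vec using ([]; _∷_)
open import Data.Product using (Σ; _×_; ∃)
open import Relation.Nullary using (¬_)
open import Relation.Binary using (Rel; IsTotalOrder)
open import Algebra.Bundles using (CommutativeRing)
open import Data.Fin.Subset renaming (_-_ to _∖_) using (Subset; _∪_; _∩_; ⁅_⁆; ⊤; ⊥; _∈_; _∉_)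

-- We work over an
-- arbitrary ordered field (ℝ being the intended instance): a commutative
-- ring with a total order compatible with + and *, 0 ≠ 1, and inverses
-- of nonzero elements.
record OrderedField (c ℓ₁ ℓ₂ : Level) : Set (lsuc (c ⊔ ℓ₁ ⊔ ℓ₂)) where
  field
    commutativeRing : CommutativeRing c ℓ₁
  open CommutativeRing commutativeRing public
  field
    _≤_          : Rel Carrier ℓ₂
    isTotalOrder : IsTotalOrder _≈_ _≤_
    +-monoˡ-≤    : ∀ {x y} z → x ≤ y → (x + z) ≤ (y + z)
    *-nonneg     : ∀ {x y} → 0# ≤ x → 0# ≤ y → 0# ≤ (x * y)
    0≉1          : ¬ (0# ≈ 1#)
    *-inverse    : ∀ x → ¬ (x ≈ 0#) → ∃ λ y → (x * y) ≈ 1#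

  _⊖_ : Carrier → Carrier → Carrier
  a ⊖ b = a + (- b)

module SubmodularDefs {c ℓ₁ ℓ₂ : Level} (F : OrderedField c ℓ₁ ℓ₂) where
  open OrderedField F hiding (zero)

  Vect : ℕ → Set c
  Vect n = Fin n → Carrier

  sumOver : ∀ {n} → Vect n → Subset n → Carrier
  sumOver {zero}  x []            = 0#
  sumOver {suc n} x (true  ∷ S)   = x Fin.zero + sumOver (λ i → x (suc i)) S
  sumOver {suc n} x (false ∷ S)   = sumOver (λ i → x (suc i)) S

  SetFn : ℕ → Set c
  SetFn n = Subset n → Carrier

  Submodular : ∀ {n} → SetFn n → Set ℓ₂
  Submodular {n} f = ∀ (S T : Subset n) → (f (S ∪ T) + f (S ∩ T)) ≤ (f S + f T)

  marg : ∀ {n} → SetFn n → Fin n → Subset n → Carrier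
  marg f j S = f (S ∪ ⁅ j ⁆) ⊖ f S

  VSet : ℕ → (a : Level) → Set (c ⊔ lsuc a)
  VSet n a = Vect n → Set a

  _⊆ᵥ_ : ∀ {n a b} → VSet n a → VSet n b → Set (c ⊔ a ⊔ b)
  A ⊆ᵥ B = ∀ x → A x → B x

  module _ {n : ℕ} (f : SetFn n) (X : Subset n) where

    hatSub : VSet n ℓ₂
    hatSub x = (∀ j → j ∈ X → x j ≤ marg f j (X ∖ j))
             × (∀ j → j ∉ X → f ⁅ j ⁆ ≤ x j)

    checkSub : VSet n ℓ₂
    checkSub x = (∀ j → j ∉ X → marg f j X ≤ x j)
               × (∀ j → j ∈ X → x j ≤ marg f j (⊤ ∖ j))

    barSub : VSet n ℓ₂
    barSub x = (∀ j → j ∈ X → x j ≤ marg f j (⊤ ∖ j))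
             × (∀ j → j ∉ X → f ⁅ j ⁆ ≤ x j)

    ringSub : VSet n (c ⊔ ℓ₁ ⊔ ℓ₂)
    ringSub x = Σ Carrier λ lam → Σ (Vect n) λ x₁ → Σ (Vect n) λ x₂ →
                  (0# ≤ lam) × (lam ≤ 1#) × hatSub x₁ × checkSub x₂ ×
                  (∀ i → x i ≈ ((lam * x₁ i) + ((1# ⊖ lam) * x₂ i)))

    subdiff : VSet n ℓ₂
    subdiff x = ∀ (Y : Subset n) → (f Y ⊖ sumOver x Y) ≤ (f X ⊖ sumOver x X)

module Submission where

-- Write  surplus x S = f S - x(S).  Then x ∈ ∂f(X) says exactly that X
-- maximises  surplus x.  Inserting j ∉ U into U changes the surplus by
-- f(j | U) - x j, and by submodularity the marginal f(j | U) decreases as U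
-- grows (diminishing returns).

open import Defs
open import Data.Product using (_×_)
open import Data.Nat using (ℕ)
import Data.Nat as ℕ
open import Data.Fin.Subset using (Subset; ⊥)

open import Level using (Level)
open import Function using (flip; _∘_)
open import Data.Product using (_,_)
open import Data.Sum using (inj₁; inj₂)
open import Data.Empty using (⊥-elim)
open import Data.Bool using (if_then_else_)
open import Data.Bool.Properties using (∨-identityʳ)
open import Data.Fin using (Fin; zero; suc)
open import Data.Vec using ([]; _∷_; here; there)
open import Data.Fin.Subset using (_∪_; _∩_; ⁅_⁆; ⊤; _-_; _∈_; _∉_; _⊆_; inside; outside)
open import Data.Fin.Subset.Properties
  using (_∈?_; ⊆-antisym; ⊆-refl; ⊥⊆; ⊆⊤; s⊆s; out⊆; drop-∷-⊆; drop-there; x∈⁅y⁆⇒x≡y;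
         x∈p∪q⁺; x∈p∪q⁻; x∈p∩q⁺; x∈p∩q⁻; p∩q⊆p; p∩q⊆q; p⊆p∪q; q⊆p∪q;
         ∪-identityˡ; ∪-identityʳ; x∈p∧x≢y⇒x∈p-y)
open import Relation.Nullary using (does)
open import Relation.Nullary.Decidable using (dec-true; dec-false)
open import Relation.Binary using (Rel; Reflexive; Transitive; IsTotalOrder)
import Relation.Binary.PropositionalEquality as ≡
open ≡ using (_≡_)
import Algebra.Properties.AbelianGroup as AbelianGroupProperties
import Algebra.Properties.CommutativeSemigroup as CommutativeSemigroupProperties
import Algebra.Properties.Ring as RingProperties

x∉p-x : ∀ {n} (p : Subset n) (x : Fin n) → x ∉ p - x
x∉p-x (s ∷ p) zero    ()
x∉p-x (s ∷ p) (suc x) (there x∈p-x) = x∉p-x p x x∈p-x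

⊆-minus : ∀ {n} {U V : Subset n} {j} → U ⊆ V → j ∉ U → U ⊆ V - j
⊆-minus U⊆V j∉U x∈U = x∈p∧x≢y⇒x∈p-y (U⊆V x∈U) λ { ≡.refl → j∉U x∈U }

module _ {n : ℕ} {S T : Subset n} {j : Fin n} (S⊆T : S ⊆ T) where

  -- The two sets produced by submodularity applied to S ∪ {j} and T ⊇ S.
  insert-∪ : (S ∪ ⁅ j ⁆) ∪ T ≡ T ∪ ⁅ j ⁆
  insert-∪ = ⊆-antisym to from
    where
    to : (S ∪ ⁅ j ⁆) ∪ T ⊆ T ∪ ⁅ j ⁆
    to x∈ with x∈p∪q⁻ (S ∪ ⁅ j ⁆) T x∈
    ... | inj₂ x∈T = x∈p∪q⁺ (inj₁ x∈T)
    ... | inj₁ x∈S∪j with x∈p∪q⁻ S ⁅ j ⁆ x∈S∪j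
    ...   | inj₁ x∈S = x∈p∪q⁺ (inj₁ (S⊆T x∈S))
    ...   | inj₂ x∈j = x∈p∪q⁺ (inj₂ x∈j)
    from : T ∪ ⁅ j ⁆ ⊆ (S ∪ ⁅ j ⁆) ∪ T
    from x∈ with x∈p∪q⁻ T ⁅ j ⁆ x∈
    ... | inj₁ x∈T = x∈p∪q⁺ (inj₂ x∈T)
    ... | inj₂ x∈j = x∈p∪q⁺ (inj₁ (x∈p∪q⁺ (inj₂ x∈j)))

  insert-∩ : j ∉ T → (S ∪ ⁅ j ⁆) ∩ T ≡ S
  insert-∩ j∉T = ⊆-antisym to from
    where
    to : (S ∪ ⁅ j ⁆) ∩ T ⊆ S
    to x∈ with x∈p∩q⁻ (S ∪ ⁅ j ⁆) T x∈
    ... | x∈S∪j , x∈T with x∈p∪q⁻ S ⁅ j ⁆ x∈S∪j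
    ...   | inj₁ x∈S = x∈S
    ...   | inj₂ x∈j with x∈⁅y⁆⇒x≡y j x∈j
    ...     | ≡.refl = ⊥-elim (j∉T x∈T)
    from : S ⊆ (S ∪ ⁅ j ⁆) ∩ T
    from x∈S = x∈p∩q⁺ (p⊆p∪q ⁅ j ⁆ x∈S , S⊆T x∈S)

module Chain {c ℓ : Level} {C : Set c} (_≼_ : Rel C ℓ)
             (≼-refl : Reflexive _≼_) (≼-trans : Transitive _≼_) where

  InsertionMonotone : ∀ {n} → (Subset n → C) → Subset n → Subset n → Set ℓ
  InsertionMonotone h S T =
    ∀ {U j} → S ⊆ U → U ⊆ T → j ∉ U → j ∈ T → h U ≼ h (U ∪ ⁅ j ⁆)

  tailMonotone : ∀ {n} {s t} {h : Subset (ℕ.suc n) → C} {S T : Subset n} →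
                 (∀ {U} → U ⊆ T → s ∷ U ⊆ t ∷ T) →
                 InsertionMonotone h (s ∷ S) (t ∷ T) → InsertionMonotone (h ∘ (s ∷_)) S T
  tailMonotone {s = s} {h = h} embed mono {U} {j} S⊆U U⊆T j∉U j∈T =
    ≡.subst (λ b → h (s ∷ U) ≼ h (b ∷ (U ∪ ⁅ j ⁆))) (∨-identityʳ s)
      (mono (s⊆s S⊆U) (embed U⊆T) (j∉U ∘ drop-there) (there j∈T))

  chain : ∀ {n} (h : Subset n → C) {S T : Subset n} →
          S ⊆ T → InsertionMonotone h S T → h S ≼ h T
  chain h {[]}          {[]}          _   _    = ≼-refl
  chain h {outside ∷ S} {outside ∷ T} S⊆T mono =
    chain (h ∘ (outside ∷_)) (drop-∷-⊆ S⊆T) (tailMonotone s⊆s mono)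
  chain h {inside ∷ S}  {inside ∷ T}  S⊆T mono =
    chain (h ∘ (inside ∷_)) (drop-∷-⊆ S⊆T) (tailMonotone s⊆s mono)
  chain h {outside ∷ S} {inside ∷ T}  S⊆T mono =
    ≼-trans (chain (h ∘ (outside ∷_)) (drop-∷-⊆ S⊆T) (tailMonotone out⊆ mono)) insertHead
    where
    insertHead : h (outside ∷ T) ≼ h (inside ∷ T)
    insertHead = ≡.subst (λ T′ → h (outside ∷ T) ≼ h (inside ∷ T′)) (∪-identityʳ T)
      (mono (s⊆s (drop-∷-⊆ S⊆T)) (out⊆ ⊆-refl) (λ ()) here)
  chain h {inside ∷ S}  {outside ∷ T} S⊆T _ with S⊆T here
  ... | ()

module OrderedFieldProperties {c ℓ₁ ℓ₂ : Level} (F : OrderedField c ℓ₁ ℓ₂) where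
  open OrderedField F hiding (zero; _-_)
  open IsTotalOrder isTotalOrder public
    using () renaming (refl to ≤-refl; trans to ≤-trans; total to ≤-total;
                       ≤-respˡ-≈ to ≤-respˡ; ≤-respʳ-≈ to ≤-respʳ)
  open AbelianGroupProperties +-abelianGroup using (⁻¹-∙-comm; ⁻¹-anti-homo-//; ⁻¹-involutive; ε⁻¹≈ε)
  open CommutativeSemigroupProperties +-commutativeSemigroup using (interchange)
  open RingProperties ring using (-‿distribˡ-*; x[y-z]≈xy-xz)
  open import Relation.Binary.Reasoning.Setoid setoid

  ⊖-anticomm : ∀ a b → - (a ⊖ b) ≈ b ⊖ a
  ⊖-anticomm = ⁻¹-anti-homo-//

  +-⊖-interchange : ∀ a b c d → (a + b) ⊖ (c + d) ≈ (a ⊖ c) + (b ⊖ d)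
  +-⊖-interchange a b c d = begin
    (a + b) + - (c + d)   ≈⟨ +-congˡ (⁻¹-∙-comm c d) ⟨
    (a + b) + (- c + - d) ≈⟨ interchange a b (- c) (- d) ⟩
    (a + - c) + (b + - d) ∎

  ⊖-interchange : ∀ a b c d → (a ⊖ b) ⊖ (c ⊖ d) ≈ (a ⊖ c) ⊖ (b ⊖ d)
  ⊖-interchange a b c d = begin
    (a + - b) ⊖ (c + - d)    ≈⟨ +-⊖-interchange a (- b) c (- d) ⟩
    (a ⊖ c) + (- b + - - d)  ≈⟨ +-congˡ (⁻¹-∙-comm b (- d)) ⟩
    (a ⊖ c) ⊖ (b ⊖ d)        ∎

  ⊖-⊖-as-sums : ∀ a b c d → (a ⊖ b) ⊖ (c ⊖ d) ≈ (a + d) ⊖ (c + b)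
  ⊖-⊖-as-sums a b c d = begin
    (a ⊖ b) ⊖ (c ⊖ d)    ≈⟨ ⊖-interchange a b c d ⟩
    (a ⊖ c) + - (b ⊖ d)  ≈⟨ +-congˡ (⊖-anticomm b d) ⟩
    (a ⊖ c) + (d ⊖ b)    ≈⟨ +-⊖-interchange a d c b ⟨
    (a + d) ⊖ (c + b)    ∎

  +-⊖-cancelˡ : ∀ a b → (a + b) ⊖ a ≈ b
  +-⊖-cancelˡ a b = begin
    (a + b) + - a  ≈⟨ +-congʳ (+-comm a b) ⟩
    (b + a) + - a  ≈⟨ +-assoc b a (- a) ⟩
    b + (a + - a)  ≈⟨ +-congˡ (-‿inverseʳ a) ⟩
    b + 0#         ≈⟨ +-identityʳ b ⟩
    b              ∎

  ⊖-+-cancel : ∀ a b → (b ⊖ a) + a ≈ b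
  ⊖-+-cancel a b = begin
    (b + - a) + a  ≈⟨ +-assoc b (- a) a ⟩
    b + (- a + a)  ≈⟨ +-congˡ (-‿inverseˡ a) ⟩
    b + 0#         ≈⟨ +-identityʳ b ⟩
    b              ∎

  ⊖-zero : ∀ a → a ⊖ 0# ≈ a
  ⊖-zero a = trans (+-congˡ ε⁻¹≈ε) (+-identityʳ a)

  +-monoʳ-≤ : ∀ {a b} c → a ≤ b → (c + a) ≤ (c + b)
  +-monoʳ-≤ {a} {b} c a≤b = ≤-respˡ (+-comm a c) (≤-respʳ (+-comm b c) (+-monoˡ-≤ c a≤b))

  +-mono-≤ : ∀ {a b c d} → a ≤ b → c ≤ d → (a + c) ≤ (b + d)
  +-mono-≤ {b = b} {c} a≤b c≤d = ≤-trans (+-monoˡ-≤ c a≤b) (+-monoʳ-≤ b c≤d)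

  ≤⇒0≤⊖ : ∀ {a b} → a ≤ b → 0# ≤ (b ⊖ a)
  ≤⇒0≤⊖ {a} a≤b = ≤-respˡ (-‿inverseʳ a) (+-monoˡ-≤ (- a) a≤b)

  0≤⊖⇒≤ : ∀ {a b} → 0# ≤ (b ⊖ a) → a ≤ b
  0≤⊖⇒≤ {a} {b} 0≤b-a = ≤-respˡ (+-identityˡ a) (≤-respʳ (⊖-+-cancel a b) (+-monoˡ-≤ a 0≤b-a))

  ≤-by-difference : ∀ {a b c d} → d ⊖ c ≈ b ⊖ a → a ≤ b → c ≤ d
  ≤-by-difference eq a≤b = 0≤⊖⇒≤ (≤-respʳ (sym eq) (≤⇒0≤⊖ a≤b))

  *-monoˡ-≤ : ∀ {l a b} → 0# ≤ l → a ≤ b → (l * a) ≤ (l * b)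
  *-monoˡ-≤ {l} {a} {b} 0≤l a≤b =
    0≤⊖⇒≤ (≤-respʳ (x[y-z]≈xy-xz l b a) (*-nonneg 0≤l (≤⇒0≤⊖ a≤b)))

  0≤1 : 0# ≤ 1#
  0≤1 with ≤-total 0# 1#
  ... | inj₁ 0≤1′ = 0≤1′
  ... | inj₂ 1≤0 = ≤-respʳ square (*-nonneg 0≤-1 0≤-1)
    where
    0≤-1 : 0# ≤ (0# ⊖ 1#)
    0≤-1 = ≤⇒0≤⊖ 1≤0
    square : (0# ⊖ 1#) * (0# ⊖ 1#) ≈ 1#
    square = begin
      (0# + - 1#) * (0# + - 1#)  ≈⟨ *-cong (+-identityˡ (- 1#)) (+-identityˡ (- 1#)) ⟩
      - 1# * - 1#                ≈⟨ -‿distribˡ-* 1# (- 1#) ⟨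
      - (1# * - 1#)              ≈⟨ -‿cong (*-identityˡ (- 1#)) ⟩
      - - 1#                     ≈⟨ ⁻¹-involutive 1# ⟩
      1#                         ∎

  convex-mono : ∀ {l a a′ b b′} → 0# ≤ l → l ≤ 1# → a ≤ a′ → b ≤ b′ →
                ((l * a) + ((1# ⊖ l) * b)) ≤ ((l * a′) + ((1# ⊖ l) * b′))
  convex-mono 0≤l l≤1 a≤a′ b≤b′ = +-mono-≤ (*-monoˡ-≤ 0≤l a≤a′) (*-monoˡ-≤ (≤⇒0≤⊖ l≤1) b≤b′)

  ⊖-affine : ∀ l v a b →
             v ⊖ ((l * a) + ((1# ⊖ l) * b)) ≈ (l * (v ⊖ a)) + ((1# ⊖ l) * (v ⊖ b))
  ⊖-affine l v a b = sym (begin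
    l * (v ⊖ a) + μ * (v ⊖ b)
      ≈⟨ +-cong (x[y-z]≈xy-xz l v a) (x[y-z]≈xy-xz μ v b) ⟩
    ((l * v) ⊖ (l * a)) + ((μ * v) ⊖ (μ * b))
      ≈⟨ +-⊖-interchange (l * v) (μ * v) (l * a) (μ * b) ⟨
    (l * v + μ * v) ⊖ (l * a + μ * b)
      ≈⟨ +-congʳ (distribʳ v l μ) ⟨
    ((l + μ) * v) ⊖ (l * a + μ * b)
      ≈⟨ +-congʳ (trans (*-congʳ l+μ≈1) (*-identityˡ v)) ⟩
    v ⊖ (l * a + μ * b)
      ∎)
    where
    μ = 1# ⊖ l
    l+μ≈1 : l + μ ≈ 1#
    l+μ≈1 = trans (+-comm l μ) (⊖-+-cancel l 1#)

  segment-start : ∀ a b → a ≈ (1# * a) + ((1# ⊖ 1#) * b)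
  segment-start a b = sym (begin
    1# * a + (1# ⊖ 1#) * b  ≈⟨ +-cong (*-identityˡ a) (*-congʳ (-‿inverseʳ 1#)) ⟩
    a + 0# * b              ≈⟨ +-congˡ (zeroˡ b) ⟩
    a + 0#                  ≈⟨ +-identityʳ a ⟩
    a                       ∎)

  segment-end : ∀ a b → b ≈ (0# * a) + ((1# ⊖ 0#) * b)
  segment-end a b = sym (begin
    0# * a + (1# ⊖ 0#) * b  ≈⟨ +-cong (zeroˡ a) (*-congʳ (⊖-zero 1#)) ⟩
    0# + 1# * b             ≈⟨ +-identityˡ (1# * b) ⟩
    1# * b                  ≈⟨ *-identityˡ b ⟩
    b                       ∎)

module SumProperties {c ℓ₁ ℓ₂ : Level} (F : OrderedField c ℓ₁ ℓ₂) where
  open OrderedField F hiding (zero; _-_)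
  open SubmodularDefs F

  sumOver-insert : ∀ {n} (x : Vect n) {U : Subset n} {j : Fin n} → j ∉ U →
                   sumOver x (U ∪ ⁅ j ⁆) ≈ sumOver x U + x j
  sumOver-insert x {outside ∷ U} {zero} _ rewrite ∪-identityʳ U = +-comm _ _
  sumOver-insert x {inside ∷ U}  {zero} j∉U = ⊥-elim (j∉U here)
  sumOver-insert x {inside ∷ U}  {suc j} j∉U =
    trans (+-congˡ (sumOver-insert (x ∘ suc) (j∉U ∘ there))) (sym (+-assoc _ _ _))
  sumOver-insert x {outside ∷ U} {suc j} j∉U = sumOver-insert (x ∘ suc) (j∉U ∘ there)

  sumOver-linear : ∀ {n} (x a b : Vect n) l μ → (∀ i → x i ≈ (l * a i) + (μ * b i)) →
                   ∀ S → sumOver x S ≈ (l * sumOver a S) + (μ * sumOver b S)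
  sumOver-linear x a b l μ x≈ [] = sym (trans (+-cong (zeroʳ l) (zeroʳ μ)) (+-identityʳ 0#))
  sumOver-linear x a b l μ x≈ (outside ∷ S) =
    sumOver-linear (x ∘ suc) (a ∘ suc) (b ∘ suc) l μ (x≈ ∘ suc) S
  sumOver-linear x a b l μ x≈ (inside ∷ S) = begin
    x zero + sumOver (x ∘ suc) S
      ≈⟨ +-cong (x≈ zero) (sumOver-linear (x ∘ suc) (a ∘ suc) (b ∘ suc) l μ (x≈ ∘ suc) S) ⟩
    (l * a zero + μ * b zero) + (l * sumOver (a ∘ suc) S + μ * sumOver (b ∘ suc) S)
      ≈⟨ interchange _ _ _ _ ⟩
    (l * a zero + l * sumOver (a ∘ suc) S) + (μ * b zero + μ * sumOver (b ∘ suc) S)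
      ≈⟨ +-cong (distribˡ l _ _) (distribˡ μ _ _) ⟨
    l * (a zero + sumOver (a ∘ suc) S) + μ * (b zero + sumOver (b ∘ suc) S) ∎
    where
    open import Relation.Binary.Reasoning.Setoid setoid
    open CommutativeSemigroupProperties +-commutativeSemigroup using (interchange)

module SetFunctionProperties {c ℓ₁ ℓ₂ : Level} (F : OrderedField c ℓ₁ ℓ₂)
                             {n : ℕ} (f : Subset n → OrderedField.Carrier F) where
  open OrderedField F hiding (zero; _-_)
  open SubmodularDefs F
  open OrderedFieldProperties F
  open SumProperties F

  surplus : Vect n → Subset n → Carrier
  surplus x S = f S ⊖ sumOver x S

  surplus-insert : ∀ x {U j} → j ∉ U →
                   surplus x (U ∪ ⁅ j ⁆) ⊖ surplus x U ≈ marg f j U ⊖ x j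
  surplus-insert x {U} {j} j∉U =
    trans (⊖-interchange (f (U ∪ ⁅ j ⁆)) (sumOver x (U ∪ ⁅ j ⁆)) (f U) (sumOver x U))
          (+-congˡ (-‿cong (trans (+-congʳ (sumOver-insert x j∉U)) (+-⊖-cancelˡ _ _))))

  surplus-grows : ∀ x {U j} → j ∉ U → x j ≤ marg f j U → surplus x U ≤ surplus x (U ∪ ⁅ j ⁆)
  surplus-grows x j∉U = ≤-by-difference (surplus-insert x j∉U)

  surplus-shrinks : ∀ x {U j} → j ∉ U → marg f j U ≤ x j → surplus x (U ∪ ⁅ j ⁆) ≤ surplus x U
  surplus-shrinks x {U} {j} j∉U = ≤-by-difference (begin
    surplus x U ⊖ surplus x (U ∪ ⁅ j ⁆)     ≈⟨ ⊖-anticomm _ _ ⟨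
    - (surplus x (U ∪ ⁅ j ⁆) ⊖ surplus x U) ≈⟨ -‿cong (surplus-insert x j∉U) ⟩
    - (marg f j U ⊖ x j)                    ≈⟨ ⊖-anticomm _ _ ⟩
    x j ⊖ marg f j U                        ∎)
    where open import Relation.Binary.Reasoning.Setoid setoid

  surplus-affine : ∀ {x a b : Vect n} l → (∀ i → x i ≈ (l * a i) + ((1# ⊖ l) * b i)) →
                   ∀ S → surplus x S ≈ (l * surplus a S) + ((1# ⊖ l) * surplus b S)
  surplus-affine {x} {a} {b} l x≈ S =
    trans (+-congˡ (-‿cong (sumOver-linear x a b l (1# ⊖ l) x≈ S)))
          (⊖-affine l (f S) (sumOver a S) (sumOver b S))

  subdiff-convex : ∀ {X} {x a b : Vect n} {l} → 0# ≤ l → l ≤ 1# →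
                   subdiff f X a → subdiff f X b →
                   (∀ i → x i ≈ (l * a i) + ((1# ⊖ l) * b i)) → subdiff f X x
  subdiff-convex {X} {l = l} 0≤l l≤1 a∈∂ b∈∂ x≈ Y =
    ≤-respˡ (sym (surplus-affine l x≈ Y)) (≤-respʳ (sym (surplus-affine l x≈ X))
      (convex-mono 0≤l l≤1 (a∈∂ Y) (b∈∂ Y)))

  module _ (submodular : Submodular f) where

    diminishing-returns : ∀ {S T j} → S ⊆ T → j ∉ T → marg f j T ≤ marg f j S
    diminishing-returns {S} {T} {j} S⊆T j∉T =
      ≤-by-difference (⊖-⊖-as-sums (f (S ∪ ⁅ j ⁆)) (f S) (f (T ∪ ⁅ j ⁆)) (f T))
        (≡.subst₂ (λ A B → (f A + f B) ≤ (f (S ∪ ⁅ j ⁆) + f T))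
          (insert-∪ S⊆T) (insert-∩ S⊆T j∉T) (submodular (S ∪ ⁅ j ⁆) T))

    marg-minus≤ : ∀ {U V j} → U ⊆ V → j ∉ U → marg f j (V - j) ≤ marg f j U
    marg-minus≤ {V = V} {j} U⊆V j∉U = diminishing-returns (⊆-minus U⊆V j∉U) (x∉p-x V j)

    marg≤singleton : f ⊥ ≈ 0# → ∀ {U j} → j ∉ U → marg f j U ≤ f ⁅ j ⁆
    marg≤singleton f⊥≈0 {j = j} j∉U = ≤-respʳ marg-∅ (diminishing-returns ⊥⊆ j∉U)
      where
      marg-∅ : marg f j ⊥ ≈ f ⁅ j ⁆
      marg-∅ = trans (+-cong (reflexive (≡.cong f (∪-identityˡ ⁅ j ⁆))) (-‿cong f⊥≈0)) (⊖-zero _)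

module Inclusions {c ℓ₁ ℓ₂ : Level} (F : OrderedField c ℓ₁ ℓ₂) {n : ℕ}
                  (f : Subset n → OrderedField.Carrier F) (submodular : SubmodularDefs.Submodular F f)
                  (f⊥≈0 : OrderedField._≈_ F (f ⊥) (OrderedField.0# F)) (X : Subset n) where
  open OrderedField F hiding (zero; _-_)
  open SubmodularDefs F
  open OrderedFieldProperties F
  open SetFunctionProperties F f
  open Chain _≤_ ≤-refl ≤-trans renaming (chain to ascend)
  open Chain (flip _≤_) ≤-refl (flip ≤-trans) renaming (chain to descend)

  -- ∂̂f(X) ⊆ ∂f(X): from Y the surplus does not decrease when removing the
  -- elements of Y ∖ X (each has marginal ≤ f({j}) ≤ x j) and then adding
  -- those of X ∖ Y (each has marginal ≥ f(j | X - j) ≥ x j).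
  hat⊆subdiff : hatSub f X ⊆ᵥ subdiff f X
  hat⊆subdiff x (below , above) Y =
    ≤-trans (descend (surplus x) (p∩q⊆p Y X) removeOutside)
            (ascend (surplus x) (p∩q⊆q Y X) addInside)
    where
    removeOutside : ∀ {U j} → Y ∩ X ⊆ U → U ⊆ Y → j ∉ U → j ∈ Y →
                    surplus x (U ∪ ⁅ j ⁆) ≤ surplus x U
    removeOutside {j = j} Y∩X⊆U _ j∉U j∈Y = surplus-shrinks x j∉U
      (≤-trans (marg≤singleton submodular f⊥≈0 j∉U) (above j j∉X))
      where
      j∉X : j ∉ X
      j∉X j∈X = j∉U (Y∩X⊆U (x∈p∩q⁺ (j∈Y , j∈X)))
    addInside : ∀ {U j} → Y ∩ X ⊆ U → U ⊆ X → j ∉ U → j ∈ X →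
                surplus x U ≤ surplus x (U ∪ ⁅ j ⁆)
    addInside _ U⊆X j∉U j∈X = surplus-grows x j∉U
      (≤-trans (below _ j∈X) (marg-minus≤ submodular U⊆X j∉U))

  -- ∂̌f(X) ⊆ ∂f(X): from Y the surplus does not decrease when adding the
  -- elements of X ∖ Y (marginal ≥ f(j | V - j) ≥ x j) and then removing
  -- those of Y ∖ X (marginal ≤ f(j | X) ≤ x j).
  check⊆subdiff : checkSub f X ⊆ᵥ subdiff f X
  check⊆subdiff x (above , below) Y =
    ≤-trans (ascend (surplus x) (p⊆p∪q X) addInside)
            (descend (surplus x) (q⊆p∪q Y X) removeOutside)
    where
    addInside : ∀ {U j} → Y ⊆ U → U ⊆ Y ∪ X → j ∉ U → j ∈ Y ∪ X →
                surplus x U ≤ surplus x (U ∪ ⁅ j ⁆)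
    addInside {j = j} Y⊆U _ j∉U j∈Y∪X = surplus-grows x j∉U
      (≤-trans (below j j∈X) (marg-minus≤ submodular ⊆⊤ j∉U))
      where
      j∈X : j ∈ X
      j∈X with x∈p∪q⁻ Y X j∈Y∪X
      ... | inj₁ j∈Y = ⊥-elim (j∉U (Y⊆U j∈Y))
      ... | inj₂ j∈X = j∈X
    removeOutside : ∀ {U j} → X ⊆ U → U ⊆ Y ∪ X → j ∉ U → j ∈ Y ∪ X →
                    surplus x (U ∪ ⁅ j ⁆) ≤ surplus x U
    removeOutside {j = j} X⊆U _ j∉U _ = surplus-shrinks x j∉U
      (≤-trans (diminishing-returns submodular X⊆U j∉U) (above j (j∉U ∘ X⊆U)))

  bar⊆hat : barSub f X ⊆ᵥ hatSub f X
  bar⊆hat x (below , above) =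
    (λ j j∈X → ≤-trans (below j j∈X) (marg-minus≤ submodular ⊆⊤ (x∉p-x X j))) , above

  bar⊆check : barSub f X ⊆ᵥ checkSub f X
  bar⊆check x (below , above) =
    (λ j j∉X → ≤-trans (marg≤singleton submodular f⊥≈0 j∉X) (above j j∉X)) , below

  barPoint : Vect n
  barPoint j = if does (j ∈? X) then marg f j (⊤ - j) else f ⁅ j ⁆

  barPoint∈bar : barSub f X barPoint
  barPoint∈bar = onX , offX
    where
    onX : ∀ j → j ∈ X → barPoint j ≤ marg f j (⊤ - j)
    onX j j∈X rewrite dec-true (j ∈? X) j∈X = ≤-refl
    offX : ∀ j → j ∉ X → f ⁅ j ⁆ ≤ barPoint j
    offX j j∉X rewrite dec-false (j ∈? X) j∉X = ≤-refl

  -- ∂̂f(X) and ∂̌f(X) are the endpoints λ = 1 and λ = 0 of the segments in ∂̊f(X).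
  hat⊆ring : hatSub f X ⊆ᵥ ringSub f X
  hat⊆ring x x∈hat = 1# , x , barPoint , 0≤1 , ≤-refl , x∈hat , bar⊆check barPoint barPoint∈bar ,
                     λ i → segment-start (x i) (barPoint i)

  check⊆ring : checkSub f X ⊆ᵥ ringSub f X
  check⊆ring x x∈check = 0# , barPoint , x , ≤-refl , 0≤1 , bar⊆hat barPoint barPoint∈bar , x∈check ,
                         λ i → segment-end (barPoint i) (x i)

  -- ∂̊f(X) ⊆ ∂f(X), since ∂f(X) is convex and contains ∂̂f(X) and ∂̌f(X).
  ring⊆subdiff : ringSub f X ⊆ᵥ subdiff f X
  ring⊆subdiff x (l , x₁ , x₂ , 0≤l , l≤1 , x₁∈hat , x₂∈check , x≈) =
    subdiff-convex 0≤l l≤1 (hat⊆subdiff x₁ x₁∈hat) (check⊆subdiff x₂ x₂∈check) x≈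

mainTheorem8 : ∀ {c ℓ₁ ℓ₂} (F : OrderedField c ℓ₁ ℓ₂) (n : ℕ)
    (f : Subset n → OrderedField.Carrier F) →
    SubmodularDefs.Submodular F f →
    OrderedField._≈_ F (f ⊥) (OrderedField.0# F) →
    (X : Subset n) →
    let open SubmodularDefs F in
    ((barSub f X ⊆ᵥ hatSub f X) × (hatSub f X ⊆ᵥ ringSub f X) × (ringSub f X ⊆ᵥ subdiff f X))
    × ((barSub f X ⊆ᵥ checkSub f X) × (checkSub f X ⊆ᵥ ringSub f X) × (ringSub f X ⊆ᵥ subdiff f X))
mainTheorem8 F n f submodular f⊥≈0 X =
  (bar⊆hat , hat⊆ring , ring⊆subdiff) , (bar⊆check , check⊆ring , ring⊆subdiff)
  where open Inclusions F f submodular f⊥≈0 X
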